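{- Let $a$ be a positive integer. A positive integer $m$ can be expressed in the form $ax+(a+1)y$ with $x,y$ nonnegative integers if and only if $\left\lfloor \frac{m}{a}\right\rfloor\ge \frac{m}{a+1}$. -}

-- Write m = a x + (a + 1) y as m = y + (x + y) a. A representation thus gives
-- s = x + y with s a ≤ m, so s ≤ m / a, and m ≤ (a + 1) s ≤ (a + 1) (m / a).
-- Conversely, with m = r + q a (q = m / a, r = m % a) the bound m ≤ (a + 1) q
-- says r ≤ q, and then x = q - r, y = r is a representation.
module Submission where

open import Data.Nat using (ℕ; _+_; _*_; _∸_; _≤_; _/_; _%_; NonZero)
open import Data.Nat.DivMod using (m≡m%n+[m/n]*n; m*n/n≡m; /-monoˡ-≤)
open import Data.Nat.Properties
  using (m≤n+m; +-monoˡ-≤; *-monoʳ-≤; +-cancelʳ-≤; m∸n+n≡m; module ≤-Reasoning)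
open import Data.Nat.Solver using (module +-*-Solver)
open import Data.Product using (∃₂; _,_)
open import Function.Bundles using (_⇔_; mk⇔)
open import Relation.Binary.PropositionalEquality
  using (_≡_; refl; sym; trans; cong; subst; module ≡-Reasoning)

open +-*-Solver

a*x+[a+1]*y≡y+[x+y]*a : ∀ a x y → a * x + (a + 1) * y ≡ y + (x + y) * a
a*x+[a+1]*y≡y+[x+y]*a = solve 3 (λ a x y →
  a :* x :+ (a :+ con 1) :* y := y :+ (x :+ y) :* a) refl

[a+1]*s≡s+s*a : ∀ a s → (a + 1) * s ≡ s + s * a
[a+1]*s≡s+s*a = solve 2 (λ a s → (a :+ con 1) :* s := s :+ s :* a) refl

s≤[y+s*a]/a : ∀ a .{{_ : NonZero a}} y s → s ≤ (y + s * a) / a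
s≤[y+s*a]/a a y s = subst (_≤ (y + s * a) / a) (m*n/n≡m s a) (/-monoˡ-≤ a (m≤n+m (s * a) y))

y≤s⇒y+s*a≤[a+1]*[y+s*a]/a : ∀ a .{{_ : NonZero a}} {y s} → y ≤ s →
                             y + s * a ≤ (a + 1) * ((y + s * a) / a)
y≤s⇒y+s*a≤[a+1]*[y+s*a]/a a {y} {s} y≤s = begin
  y + s * a                   ≤⟨ +-monoˡ-≤ (s * a) y≤s ⟩
  s + s * a                   ≡⟨ sym ([a+1]*s≡s+s*a a s) ⟩
  (a + 1) * s                 ≤⟨ *-monoʳ-≤ (a + 1) (s≤[y+s*a]/a a y s) ⟩
  (a + 1) * ((y + s * a) / a) ∎
  where open ≤-Reasoning

m≤[a+1]*[m/a]⇒m%a≤m/a : ∀ a .{{_ : NonZero a}} m → m ≤ (a + 1) * (m / a) → m % a ≤ m / a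
m≤[a+1]*[m/a]⇒m%a≤m/a a m m≤ = +-cancelʳ-≤ (q * a) (m % a) q (begin
  m % a + q * a ≡⟨ sym (m≡m%n+[m/n]*n m a) ⟩
  m             ≤⟨ m≤ ⟩
  (a + 1) * q   ≡⟨ [a+1]*s≡s+s*a a q ⟩
  q + q * a     ∎)
  where
  q = m / a
  open ≤-Reasoning

quotient-remainder-representation : ∀ a .{{_ : NonZero a}} m → m % a ≤ m / a →
                 m ≡ a * (m / a ∸ m % a) + (a + 1) * (m % a)
quotient-remainder-representation a m r≤q = begin
  m                         ≡⟨ m≡m%n+[m/n]*n m a ⟩
  r + q * a                 ≡⟨ cong (λ s → r + s * a) (sym (m∸n+n≡m r≤q)) ⟩
  r + (q ∸ r + r) * a       ≡⟨ sym (a*x+[a+1]*y≡y+[x+y]*a a (q ∸ r) r) ⟩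
  a * (q ∸ r) + (a + 1) * r ∎
  where
  q = m / a
  r = m % a
  open ≡-Reasoning

lemma6 : (a : ℕ) → .{{_ : NonZero a}} → (m : ℕ) → 1 ≤ m →
         (∃₂ λ (x y : ℕ) → m ≡ a * x + (a + 1) * y) ⇔ (m ≤ (a + 1) * (m / a))
lemma6 a m _ = mk⇔ bound witness
  where
  bound : (∃₂ λ (x y : ℕ) → m ≡ a * x + (a + 1) * y) → m ≤ (a + 1) * (m / a)
  bound (x , y , m≡) = subst (λ n → n ≤ (a + 1) * (n / a)) (sym m≡′)
                         (y≤s⇒y+s*a≤[a+1]*[y+s*a]/a a (m≤n+m y x))
    where
    m≡′ : m ≡ y + (x + y) * a
    m≡′ = trans m≡ (a*x+[a+1]*y≡y+[x+y]*a a x y)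

  witness : m ≤ (a + 1) * (m / a) → ∃₂ λ (x y : ℕ) → m ≡ a * x + (a + 1) * y
  witness m≤ = m / a ∸ m % a , m % a
             , quotient-remainder-representation a m (m≤[a+1]*[m/a]⇒m%a≤m/a a m m≤)
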